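{- Let $q$ be a prime power. For each positive integer $m \leq q - 2$, \[ \sum_{d \mid \gcd(q - 1, m)} \varphi(d) \binom{(q-1)/d}{m/d} < 3 \binom{q-1}{m}. \]
   Context: $\varphi$ is Euler's totient function; the sum is over positive divisors $d$ of $\gcd(q-1,m)$. -}

module Defs where

open import Data.Nat using (ℕ; zero; suc; _+_; _*_; _∸_; _^_; _≤_; _<_)
open import Data.Nat.DivMod using (_/_)
open import Data.Nat.Divisibility using (_∣_; _∣?_)
open import Data.Nat.Coprimality using (coprime?)
open import Data.Nat.GCD using (gcd)
open import Data.Nat.Primality using (Prime)
open import Data.Nat.Combinatorics using (_C_)
open import Data.List using (List; length; filter; upTo)
open import Data.Product using (Σ; _×_)
open import Relation.Nullary using (yes; no)
open import Relation.Binary.PropositionalEquality using (_≡_)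

IsPrimePower : ℕ → Set
IsPrimePower q = Σ ℕ λ p → Σ ℕ λ k → Prime p × (1 ≤ k × q ≡ p ^ k)

φ : ℕ → ℕ
φ n = length (filter (λ k → coprime? (suc k) n) (upTo n))

divisorSumUpTo : ℕ → ℕ → (ℕ → ℕ) → ℕ
divisorSumUpTo g zero f = 0
divisorSumUpTo g (suc e) f with suc e ∣? g
... | yes _ = divisorSumUpTo g e f + f (suc e)
... | no _ = divisorSumUpTo g e f

-- Σ_{d ∣ gcd(q-1, m)} φ(d) · C((q-1)/d, m/d)
-- d ranges over positive divisors; written with d = suc e so division is defined
term : ℕ → ℕ → ℕ → ℕ
term q m zero = 0
term q m (suc e) = φ (suc e) * (((q ∸ 1) / suc e) C (m / suc e))

lhs : ℕ → ℕ → ℕ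
lhs q m = divisorSumUpTo (gcd (q ∸ 1) m) (gcd (q ∸ 1) m) (term q m)

{-# OPTIONS --safe #-}
-- Write n = q - 1. The d = 1 summand is C(n, m). For a divisor d ≥ 2 of gcd(n, m) put
-- n = d a and m = d b, so 0 < b < a and C(a, b) ≥ 2; the superadditivity
-- C(x, u) C(y, v) ≤ C(x + y, u + v) then gives 2^(d-1) C(a, b) ≤ C(n, m), and φ(d) ≤ d - 1,
-- so the d-th summand is at most (d - 1)/2^(d-1) · C(n, m). As Σ_{j ≥ 1} j/2^j = 2 and
-- C(n, m) > 0, the whole sum is below 3 C(n, m).
module Submission where

open import Defs
open import Data.Nat using (ℕ; zero; suc; _+_; _*_; _∸_; _^_; _≤_; _<_; z≤n; s≤s; NonZero; >-nonZero)
open import Data.Nat.Properties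
open import Data.Nat.Combinatorics using (_C_; nCk+nC[k+1]≡[n+1]C[k+1])
open import Data.Nat.Divisibility using (_∣_; _∣?_; ∣-refl; ∣-trans; ∣⇒≤)
open import Data.Nat.DivMod using (_/_; m*[n/m]≡n; n/1≡n; m≥n⇒m/n>0)
open import Data.Nat.GCD using (gcd; gcd[m,n]∣m; gcd[m,n]∣n)
open import Data.Nat.Coprimality using (Coprime; coprime?)
open import Data.Nat.Tactic.RingSolver using (solve; solve-∀)
open import Data.List using (upTo; _∷_; [])
open import Data.List.Properties using (filter-notAll; length-upTo)
open import Data.List.Membership.Propositional using (lose)
open import Data.List.Membership.Propositional.Properties using (∈-upTo⁺)
open import Data.Product using (_,_)
open import Relation.Nullary using (yes; no; ¬_)
open import Relation.Binary.PropositionalEquality using (_≡_; sym; cong₂; subst₂)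
open import Algebra.Properties.CommutativeSemigroup *-commutativeSemigroup using (x∙yz≈y∙xz)

[1+n]C[1+k]≡nCk+nC[1+k] : ∀ n k → suc n C suc k ≡ n C k + n C suc k
[1+n]C[1+k]≡nCk+nC[1+k] n k = sym (nCk+nC[k+1]≡[n+1]C[k+1] n k)

k≤n⇒nCk>0 : ∀ {n k} → k ≤ n → 0 < n C k
k≤n⇒nCk>0 {n} {zero} _ = s≤s z≤n
k≤n⇒nCk>0 {suc n} {suc k} (s≤s k≤n) rewrite [1+n]C[1+k]≡nCk+nC[1+k] n k =
  ≤-trans (k≤n⇒nCk>0 k≤n) (m≤m+n _ _)

0<k<n⇒nCk≥2 : ∀ {n k} → 0 < k → k < n → 2 ≤ n C k
0<k<n⇒nCk≥2 {suc n} {suc k} _ (s≤s k<n) rewrite [1+n]C[1+k]≡nCk+nC[1+k] n k =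
  +-mono-≤ (k≤n⇒nCk>0 (≤-trans (n≤1+n k) k<n)) (k≤n⇒nCk>0 k<n)

C-monoˡ : ∀ m n k → n C k ≤ (m + n) C k
C-monoˡ zero    n k       = ≤-refl
C-monoˡ (suc m) n zero    = ≤-refl
C-monoˡ (suc m) n (suc k) rewrite [1+n]C[1+k]≡nCk+nC[1+k] (m + n) k =
  ≤-trans (C-monoˡ m n (suc k)) (m≤n+m _ _)

-- The left side is one summand of Vandermonde's Σᵢ C(x, i) C(y, u + v - i).
C*C≤C[+] : ∀ x y u v → (x C u) * (y C v) ≤ (x + y) C (u + v)
C*C≤C[+] zero    y zero    v = ≤-reflexive (+-identityʳ (y C v))
C*C≤C[+] zero    y (suc u) v = z≤n
C*C≤C[+] (suc x) y zero    v = ≤-trans (≤-reflexive (+-identityʳ (y C v))) (C-monoˡ (suc x) y v)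
C*C≤C[+] (suc x) y (suc u) v
  rewrite [1+n]C[1+k]≡nCk+nC[1+k] x u | [1+n]C[1+k]≡nCk+nC[1+k] (x + y) (u + v) =
  ≤-trans (≤-reflexive (*-distribʳ-+ (y C v) (x C u) (x C suc u)))
          (+-mono-≤ (C*C≤C[+] x y u v) (C*C≤C[+] x y (suc u) v))

2^d*aCb≤[1+d]aC[1+d]b : ∀ {a b} → 0 < b → b < a → ∀ d → 2 ^ d * (a C b) ≤ (suc d * a) C (suc d * b)
2^d*aCb≤[1+d]aC[1+d]b {a} {b} _   _   zero
  rewrite *-identityˡ (a C b) | +-identityʳ a | +-identityʳ b = ≤-refl
2^d*aCb≤[1+d]aC[1+d]b {a} {b} 0<b b<a (suc d) = begin
  2 * 2 ^ d * (a C b)                  ≡⟨ *-assoc 2 (2 ^ d) (a C b) ⟩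
  2 * (2 ^ d * (a C b))                ≤⟨ *-mono-≤ (0<k<n⇒nCk≥2 0<b b<a) (2^d*aCb≤[1+d]aC[1+d]b 0<b b<a d) ⟩
  (a C b) * ((suc d * a) C (suc d * b)) ≤⟨ C*C≤C[+] a (suc d * a) b (suc d * b) ⟩
  (suc (suc d) * a) C (suc (suc d) * b) ∎
  where open ≤-Reasoning

φ[2+k]≤1+k : ∀ k → φ (2 + k) ≤ suc k
φ[2+k]≤1+k k = ≤-pred (≤-trans
  (filter-notAll (λ j → coprime? (suc j) (2 + k)) (upTo (2 + k))
    (lose (∈-upTo⁺ {2 + k} {suc k} ≤-refl) [2+k]-not-coprime-to-itself))
  (≤-reflexive (length-upTo (2 + k))))
  where
  [2+k]-not-coprime-to-itself : ¬ Coprime (2 + k) (2 + k)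
  [2+k]-not-coprime-to-itself coprime with () ← coprime (∣-refl , ∣-refl)

divisorSumUpTo-suc-≤ : ∀ {g e c} w f → (suc e ∣ g → w * f (suc e) ≤ c) →
                       w * divisorSumUpTo g (suc e) f ≤ w * divisorSumUpTo g e f + c
divisorSumUpTo-suc-≤ {g} {e} w f bound with suc e ∣? g
... | yes d∣g = ≤-trans (≤-reflexive (*-distribˡ-+ w (divisorSumUpTo g e f) (f (suc e))))
                        (+-monoʳ-≤ (w * divisorSumUpTo g e f) (bound d∣g))
... | no _    = m≤m+n _ _

module DivisorSumBound
  (g N : ℕ) (f : ℕ → ℕ) (f[1]≤N : f 1 ≤ N)
  (f[2+k]≤ : ∀ k → 2 + k ∣ g → 2 ^ suc k * f (2 + k) ≤ suc k * N)
  where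

  open ≤-Reasoning

  -- N (1 + Σ_{j=1}^{k} j/2^j) = N (3 - (k+2)/2^k), multiplied through by 2^k.
  partialSum-bound : ∀ k → 2 ^ k * divisorSumUpTo g (suc k) f + (2 + k) * N ≤ 3 * 2 ^ k * N
  partialSum-bound zero = begin
    1 * divisorSumUpTo g 1 f + 2 * N ≤⟨ +-monoˡ-≤ (2 * N) (divisorSumUpTo-suc-≤ {g} {0} 1 f λ _ → 1*f[1]≤N) ⟩
    1 * 0 + N + 2 * N               ≡⟨ solve (N ∷ []) ⟩
    3 * 1 * N                       ∎
    where
    1*f[1]≤N : 1 * f 1 ≤ N
    1*f[1]≤N = ≤-trans (≤-reflexive (*-identityˡ (f 1))) f[1]≤N
  partialSum-bound (suc k) = begin
    2 ^ suc k * divisorSumUpTo g (2 + k) f + (3 + k) * N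
      ≤⟨ +-monoˡ-≤ ((3 + k) * N) (divisorSumUpTo-suc-≤ {g} {suc k} (2 ^ suc k) f (f[2+k]≤ k)) ⟩
    2 * P * S + suc k * N + (3 + k) * N ≡⟨ regroup P S N k ⟩
    2 * (P * S + (2 + k) * N)           ≤⟨ *-monoʳ-≤ 2 (partialSum-bound k) ⟩
    2 * (3 * P * N)                     ≡⟨ reassoc P N ⟩
    3 * (2 * P) * N                     ∎
    where
    P = 2 ^ k
    S = divisorSumUpTo g (suc k) f
    regroup : ∀ P S N k → 2 * P * S + suc k * N + (3 + k) * N ≡ 2 * (P * S + (2 + k) * N)
    regroup = solve-∀
    reassoc : ∀ P N → 2 * (3 * P * N) ≡ 3 * (2 * P) * N
    reassoc = solve-∀

  divisorSumUpTo<3N : 0 < N → ∀ e → divisorSumUpTo g e f < 3 * N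
  divisorSumUpTo<3N 0<N zero    = ≤-trans 0<N (m≤m+n N (2 * N))
  divisorSumUpTo<3N 0<N (suc k) = *-cancelˡ-< P S (3 * N) (begin-strict
    P * S               <⟨ m<m+n (P * S) (≤-trans 0<N (m≤m+n N (suc k * N))) ⟩
    P * S + (2 + k) * N ≤⟨ partialSum-bound k ⟩
    3 * P * N           ≡⟨ reassoc P N ⟩
    P * (3 * N)         ∎)
    where
    P = 2 ^ k
    S = divisorSumUpTo g (suc k) f
    reassoc : ∀ P N → 3 * P * N ≡ P * (3 * N)
    reassoc = solve-∀
    instance
      _ : NonZero P
      _ = m^n≢0 2 k

2^[1+k]*φd*[n/d]C[m/d]≤[1+k]*nCm : ∀ {n m} k → 0 < m → m < n → 2 + k ∣ n → 2 + k ∣ m →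
  2 ^ suc k * (φ (2 + k) * ((n / (2 + k)) C (m / (2 + k)))) ≤ suc k * (n C m)
2^[1+k]*φd*[n/d]C[m/d]≤[1+k]*nCm {n} {m} k 0<m m<n d∣n d∣m = begin
  2 ^ suc k * (φ d * (a C b)) ≡⟨ x∙yz≈y∙xz (2 ^ suc k) (φ d) (a C b) ⟩
  φ d * (2 ^ suc k * (a C b)) ≤⟨ *-mono-≤ (φ[2+k]≤1+k k) (2^d*aCb≤[1+d]aC[1+d]b 0<b b<a (suc k)) ⟩
  suc k * ((d * a) C (d * b)) ≡⟨ cong₂ (λ x y → suc k * (x C y)) d*a≡n d*b≡m ⟩
  suc k * (n C m)             ∎
  where
  open ≤-Reasoning
  d = 2 + k
  a = n / d
  b = m / d
  d*a≡n : d * a ≡ n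
  d*a≡n = m*[n/m]≡n d∣n
  d*b≡m : d * b ≡ m
  d*b≡m = m*[n/m]≡n d∣m
  0<b : 0 < b
  0<b = m≥n⇒m/n>0 (∣⇒≤ ⦃ >-nonZero 0<m ⦄ d∣m)
  b<a : b < a
  b<a = *-cancelˡ-< d b a (subst₂ _<_ (sym d*b≡m) (sym d*a≡n) m<n)

0<m≤n∸2⇒m<n∸1 : ∀ {m} n → 0 < m → m ≤ n ∸ 2 → m < n ∸ 1
0<m≤n∸2⇒m<n∸1 (suc (suc n)) _         m≤n = s≤s m≤n
0<m≤n∸2⇒m<n∸1 zero          (s≤s z≤n) ()
0<m≤n∸2⇒m<n∸1 (suc zero)    (s≤s z≤n) ()

lemma6 : (q m : ℕ) → IsPrimePower q → 1 ≤ m → m ≤ q ∸ 2 →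
    lhs q m < 3 * ((q ∸ 1) C m)
lemma6 q m _ 0<m m≤q-2 =
  DivisorSumBound.divisorSumUpTo<3N g N (term q m) term[1]≤N term[2+k]≤ (k≤n⇒nCk>0 (<⇒≤ m<n)) g
  where
  n = q ∸ 1
  N = n C m
  g = gcd n m
  m<n : m < n
  m<n = 0<m≤n∸2⇒m<n∸1 q 0<m m≤q-2
  term[1]≤N : term q m 1 ≤ N
  term[1]≤N rewrite n/1≡n n | n/1≡n m = ≤-reflexive (+-identityʳ N)
  term[2+k]≤ : ∀ k → 2 + k ∣ g → 2 ^ suc k * term q m (2 + k) ≤ suc k * N
  term[2+k]≤ k d∣g = 2^[1+k]*φd*[n/d]C[m/d]≤[1+k]*nCm k 0<m m<n (∣-trans d∣g (gcd[m,n]∣m n m)) (∣-trans d∣g (gcd[m,n]∣n n m))
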